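{- In each of the logics DmBL and DmBL$_\ast$, for all $\phi,\psi,\eta\in\mathcal{L}$: $(\neg\psi|\phi)\equiv\neg(\psi|\phi)$, $(\psi\wedge\eta|\phi)\equiv(\psi|\phi)\wedge(\eta|\phi)$, $(\psi\vee\eta|\phi)\equiv(\psi|\phi)\vee(\eta|\phi)$, and $(\psi\rightarrow\eta|\phi)\equiv(\psi|\phi)\rightarrow(\eta|\phi)$. Moreover $\vdash\Box\psi\rightarrow\Box(\psi|\phi)$; in particular $(\top|\phi)\equiv\top$ and $(\bot|\phi)\equiv\bot$.
   Context: Fix a set $\Theta$ of atomic propositions. The language $\mathcal{L}$ is the smallest set containing $\Theta$ and closed under the formation of $\neg\phi$, $\Box\phi$, $\phi\rightarrow\psi$ and the conditional $(\psi|\phi)$; $(\psi\wedge\eta|\phi)$ denotes $((\psi\wedge\eta)|\phi)$, etc. Abbreviations: $\phi\vee\psi=\neg\phi\rightarrow\psi$, $\phi\wedge\psi=\neg(\neg\phi\vee\neg\psi)$, $\phi\leftrightarrow\psi=(\phi\rightarrow\psi)\wedge(\psi\rightarrow\phi)$, $\top=\theta_0\rightarrow\theta_0$ for a fixed $\theta_0\in\Theta$, $\bot=\neg\top$, $\Diamond\phi=\neg\Box\neg\phi$, and (logical independence) $\psi\times\phi=\Box\bigl((\psi|\phi)\leftrightarrow\psi\bigr)$. The theorems ($\vdash$) of DmBL are the smallest set containing all instances of the axiom schemes below and closed under modus ponens (from $\vdash\phi$ and $\vdash\phi\rightarrow\psi$ infer $\vdash\psi$) and necessitation m1 (from $\vdash\phi$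 infer $\vdash\Box\phi$): c1 $\phi\rightarrow(\psi\rightarrow\phi)$; c2 $(\eta\rightarrow(\phi\rightarrow\psi))\rightarrow((\eta\rightarrow\phi)\rightarrow(\eta\rightarrow\psi))$; c3 $(\neg\phi\rightarrow\neg\psi)\rightarrow((\neg\phi\rightarrow\psi)\rightarrow\phi)$; m2 $\Box(\phi\rightarrow\psi)\rightarrow(\Box\phi\rightarrow\Box\psi)$; m3 $\Box\phi\rightarrow\phi$; b1 $\Box(\phi\rightarrow\psi)\rightarrow(\Box\neg\phi\vee\Box(\psi|\phi))$; b2 $((\psi\rightarrow\eta)|\phi)\rightarrow((\psi|\phi)\rightarrow(\eta|\phi))$; b3 $(\psi|\phi)\rightarrow(\phi\rightarrow\psi)$; b4 $\neg(\neg\psi|\phi)\leftrightarrow(\psi|\phi)$; b5 $(\psi\times\phi)\leftrightarrow(\phi\times\psi)$. The logic DmBL$_\ast$ is defined in the same way but with b5 replaced by the two schemes b5.weak.A $(\psi\times\neg\phi)\leftrightarrow(\psi\times\phi)$ and b5.weak.B $\Box(\psi\leftrightarrow\eta)\rightarrow\Box((\phi|\psi)\leftrightarrow(\phi|\eta))$. $\phi\equiv\psi$ means $\vdash\phi\leftrightarrow\psi$. -}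

module Defs where

data Logic : Set where
  DmBL DmBL∗ : Logic

data Form (Θ : Set) : Set where
  atom : Θ → Form Θ
  ¬'_  : Form Θ → Form Θ
  □_   : Form Θ → Form Θ
  _⇒_  : Form Θ → Form Θ → Form Θ
  _∣_  : Form Θ → Form Θ → Form Θ

infixr 20 _⇒_
infix 25 _∣_

module Abbrev {Θ : Set} (θ₀ : Θ) where
  infixr 22 _∨'_
  infixr 23 _∧'_
  infix 21 _⇔_
  _∨'_ : Form Θ → Form Θ → Form Θ
  φ ∨' ψ = (¬' φ) ⇒ ψ
  _∧'_ : Form Θ → Form Θ → Form Θ
  φ ∧' ψ = ¬' ((¬' φ) ∨' (¬' ψ))
  _⇔_ : Form Θ → Form Θ → Form Θ
  φ ⇔ ψ = (φ ⇒ ψ) ∧' (ψ ⇒ φ)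
  ⊤' : Form Θ
  ⊤' = atom θ₀ ⇒ atom θ₀
  ⊥' : Form Θ
  ⊥' = ¬' ⊤'
  ◇_ : Form Θ → Form Θ
  ◇ φ = ¬' (□ (¬' φ))
  _⊗_ : Form Θ → Form Θ → Form Θ
  ψ ⊗ φ = □ ((ψ ∣ φ) ⇔ ψ)

  data ⊢[_]_ : Logic → Form Θ → Set where
    c1 : ∀ {L} φ ψ → ⊢[ L ] (φ ⇒ (ψ ⇒ φ))
    c2 : ∀ {L} η φ ψ → ⊢[ L ] ((η ⇒ (φ ⇒ ψ)) ⇒ ((η ⇒ φ) ⇒ (η ⇒ ψ)))
    c3 : ∀ {L} φ ψ → ⊢[ L ] (((¬' φ) ⇒ (¬' ψ)) ⇒ (((¬' φ) ⇒ ψ) ⇒ φ))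
    m2 : ∀ {L} φ ψ → ⊢[ L ] ((□ (φ ⇒ ψ)) ⇒ ((□ φ) ⇒ (□ ψ)))
    m3 : ∀ {L} φ → ⊢[ L ] ((□ φ) ⇒ φ)
    b1 : ∀ {L} φ ψ → ⊢[ L ] ((□ (φ ⇒ ψ)) ⇒ ((□ (¬' φ)) ∨' (□ (ψ ∣ φ))))
    b2 : ∀ {L} φ ψ η → ⊢[ L ] (((ψ ⇒ η) ∣ φ) ⇒ ((ψ ∣ φ) ⇒ (η ∣ φ)))
    b3 : ∀ {L} φ ψ → ⊢[ L ] ((ψ ∣ φ) ⇒ (φ ⇒ ψ))
    b4 : ∀ {L} φ ψ → ⊢[ L ] ((¬' ((¬' ψ) ∣ φ)) ⇔ (ψ ∣ φ))
    b5 : ∀ φ ψ → ⊢[ DmBL ] ((ψ ⊗ φ) ⇔ (φ ⊗ ψ))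
    b5-weak-A : ∀ φ ψ → ⊢[ DmBL∗ ] ((ψ ⊗ (¬' φ)) ⇔ (ψ ⊗ φ))
    b5-weak-B : ∀ φ ψ η → ⊢[ DmBL∗ ] ((□ (ψ ⇔ η)) ⇒ (□ ((φ ∣ ψ) ⇔ (φ ∣ η))))
    mp : ∀ {L φ ψ} → ⊢[ L ] φ → ⊢[ L ] (φ ⇒ ψ) → ⊢[ L ] ψ
    m1 : ∀ {L φ} → ⊢[ L ] φ → ⊢[ L ] (□ φ)

  _≡[_]_ : Form Θ → Logic → Form Θ → Set
  φ ≡[ L ] ψ = ⊢[ L ] (φ ⇔ ψ)

  infix 5 ⊢[_]_
  infix 5 _≡[_]_

{-# OPTIONS --safe #-}
module Submission where

open import Data.List using (List; []; _∷_)
open import Data.List.Membership.Propositional using (_∈_)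
open import Data.List.Relation.Binary.Subset.Propositional using (_⊆_)
open import Data.List.Relation.Unary.Any using (here; there)
open import Data.Product using (_×_; _,_)
open import Relation.Binary.PropositionalEquality using (refl)

open import Defs

-- Everything rests on  □ψ → □(ψ|φ).  Through necessitation it makes every theorem
-- a conditional theorem, so by b2 the map (·|φ) is monotone; monotonicity together
-- with b4 makes (·|φ) commute with ¬ and →, hence with every connective.
--
-- For □ψ → □(ψ|φ): by b3 and b4 a necessary ψ makes every formula independent of
-- ψ, and b5 turns φ × ψ into ψ × φ = □((ψ|φ) ↔ ψ).  Without b5, if φ is possible
-- then b1 applied to □(φ → ψ) already gives □(ψ|φ); otherwise □¬φ, so ¬φ is
-- possible, b1 gives □(ψ|¬φ), hence ψ × ¬φ, which b5.weak.A turns into ψ × φ.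

module Calculus {Θ : Set} (θ₀ : Θ) where
  open Abbrev θ₀

  module Derivations (L : Logic) where

    -- Hypotheses are used only through modus ponens: necessitation stays confined
    -- to closed theorems (thm), which is what makes ⇒-intro sound.
    infix 4 _⊢_
    data _⊢_ (Γ : List (Form Θ)) : Form Θ → Set where
      hyp    : ∀ {a} → a ∈ Γ → Γ ⊢ a
      thm    : ∀ {a} → ⊢[ L ] a → Γ ⊢ a
      ⇒-elim : ∀ {a b} → Γ ⊢ a ⇒ b → Γ ⊢ a → Γ ⊢ b

    private
      variable
        Γ Δ : List (Form Θ)
        a b c d : Form Θ

    weaken : Γ ⊆ Δ → Γ ⊢ a → Δ ⊢ a
    weaken Γ⊆Δ (hyp a∈Γ)    = hyp (Γ⊆Δ a∈Γ)
    weaken Γ⊆Δ (thm t)      = thm t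
    weaken Γ⊆Δ (⇒-elim f x) = ⇒-elim (weaken Γ⊆Δ f) (weaken Γ⊆Δ x)

    wk : Γ ⊢ a → (b ∷ Γ) ⊢ a
    wk = weaken there

    var₀ : (a ∷ Γ) ⊢ a
    var₀ = hyp (here refl)

    var₁ : (b ∷ a ∷ Γ) ⊢ a
    var₁ = hyp (there (here refl))

    var₂ : (c ∷ b ∷ a ∷ Γ) ⊢ a
    var₂ = hyp (there (there (here refl)))

    ⇒-refl : ⊢[ L ] (a ⇒ a)
    ⇒-refl {a} = mp (c1 a a) (mp (c1 a (a ⇒ a)) (c2 a (a ⇒ a) a))

    ⇒-intro : (a ∷ Γ) ⊢ b → Γ ⊢ a ⇒ b
    ⇒-intro (hyp (here refl)) = thm ⇒-refl
    ⇒-intro (hyp (there b∈Γ)) = ⇒-elim (thm (c1 _ _)) (hyp b∈Γ)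
    ⇒-intro (thm t)           = ⇒-elim (thm (c1 _ _)) (thm t)
    ⇒-intro (⇒-elim f x)      = ⇒-elim (⇒-elim (thm (c2 _ _ _)) (⇒-intro f)) (⇒-intro x)

    closed : [] ⊢ a → ⊢[ L ] a
    closed (thm t)      = t
    closed (⇒-elim f x) = mp (closed x) (closed f)

    by-contradiction : ((¬' a) ∷ Γ) ⊢ b → ((¬' a) ∷ Γ) ⊢ ¬' b → Γ ⊢ a
    by-contradiction {a} {b = b} x ¬x = ⇒-elim (⇒-elim (thm (c3 a b)) (⇒-intro ¬x)) (⇒-intro x)

    ¬-elim : Γ ⊢ ¬' a → Γ ⊢ a → Γ ⊢ b
    ¬-elim ¬x x = by-contradiction (wk x) (wk ¬x)

    ¬¬-elim : Γ ⊢ ¬' (¬' a) → Γ ⊢ a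
    ¬¬-elim ¬¬x = by-contradiction var₀ (wk ¬¬x)

    ¬-intro : (a ∷ Γ) ⊢ b → (a ∷ Γ) ⊢ ¬' b → Γ ⊢ ¬' a
    ¬-intro x ¬x =
      by-contradiction (⇒-elim (wk (⇒-intro x)) (¬¬-elim var₀))
                       (⇒-elim (wk (⇒-intro ¬x)) (¬¬-elim var₀))

    ¬¬-intro : Γ ⊢ a → Γ ⊢ ¬' (¬' a)
    ¬¬-intro x = ¬-intro (wk x) var₀

    cases : (a ∷ Γ) ⊢ c → ((¬' a) ∷ Γ) ⊢ c → Γ ⊢ c
    cases {a = a} x y = by-contradiction {b = a}
      (by-contradiction (⇒-elim (wk (wk (⇒-intro y))) var₀) var₁)
      (¬-intro (⇒-elim (wk (wk (⇒-intro x))) var₀) var₁)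

    ∧-intro : Γ ⊢ a → Γ ⊢ b → Γ ⊢ a ∧' b
    ∧-intro x y = ¬-intro (wk y) (⇒-elim var₀ (¬¬-intro (wk x)))

    ∧-elimˡ : Γ ⊢ a ∧' b → Γ ⊢ a
    ∧-elimˡ x∧y = by-contradiction (⇒-intro (¬-elim var₀ var₁)) (wk x∧y)

    ∧-elimʳ : Γ ⊢ a ∧' b → Γ ⊢ b
    ∧-elimʳ x∧y = by-contradiction (⇒-intro var₁) (wk x∧y)

    ⇔-intro : (a ∷ Γ) ⊢ b → (b ∷ Γ) ⊢ a → Γ ⊢ a ⇔ b
    ⇔-intro x y = ∧-intro (⇒-intro x) (⇒-intro y)

    ⇔-to : Γ ⊢ a ⇔ b → Γ ⊢ a → Γ ⊢ b
    ⇔-to e = ⇒-elim (∧-elimˡ e)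

    ⇔-from : Γ ⊢ a ⇔ b → Γ ⊢ b → Γ ⊢ a
    ⇔-from e = ⇒-elim (∧-elimʳ e)

    ⇔-refl : Γ ⊢ a ⇔ a
    ⇔-refl = ⇔-intro var₀ var₀

    ⇔-trans : Γ ⊢ a ⇔ b → Γ ⊢ b ⇔ c → Γ ⊢ a ⇔ c
    ⇔-trans e f = ⇔-intro (⇔-to (wk f) (⇔-to (wk e) var₀)) (⇔-from (wk e) (⇔-from (wk f) var₀))

    ⇔-of-derivables : Γ ⊢ a → Γ ⊢ b → Γ ⊢ a ⇔ b
    ⇔-of-derivables x y = ⇔-intro (wk y) (wk x)

    ¬¬-⇔ : Γ ⊢ a ⇔ (¬' (¬' a))
    ¬¬-⇔ = ⇔-intro (¬¬-intro var₀) (¬¬-elim var₀)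

    ¬-cong : Γ ⊢ a ⇔ b → Γ ⊢ (¬' a) ⇔ (¬' b)
    ¬-cong e = ⇔-intro (¬-intro (⇔-from (wk (wk e)) var₀) var₁)
                       (¬-intro (⇔-to (wk (wk e)) var₀) var₁)

    ⇒-cong : Γ ⊢ a ⇔ b → Γ ⊢ c ⇔ d → Γ ⊢ (a ⇒ c) ⇔ (b ⇒ d)
    ⇒-cong e f = ⇔-intro (⇒-intro (⇔-to (wk (wk f)) (⇒-elim var₁ (⇔-from (wk (wk e)) var₀))))
                         (⇒-intro (⇔-from (wk (wk f)) (⇒-elim var₁ (⇔-to (wk (wk e)) var₀))))

    □-elim : Γ ⊢ □ a → Γ ⊢ a
    □-elim = ⇒-elim (thm (m3 _))

    □-⇒-elim : Γ ⊢ □ (a ⇒ b) → Γ ⊢ □ a → Γ ⊢ □ b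
    □-⇒-elim f = ⇒-elim (⇒-elim (thm (m2 _ _)) f)

    □-map : (a ∷ []) ⊢ b → Γ ⊢ □ a → Γ ⊢ □ b
    □-map x = □-⇒-elim (thm (m1 (closed (⇒-intro x))))

    □-map₂ : (b ∷ a ∷ []) ⊢ c → Γ ⊢ □ a → Γ ⊢ □ b → Γ ⊢ □ c
    □-map₂ x p q = □-⇒-elim (□-map (⇒-intro x) p) q

    □⇒◇ : Γ ⊢ □ a → Γ ⊢ ◇ a
    □⇒◇ x = ¬-intro (wk (□-elim x)) (□-elim var₀)

    ∣-elim : Γ ⊢ a ∣ b → Γ ⊢ b → Γ ⊢ a
    ∣-elim {a = a} {b} x = ⇒-elim (⇒-elim (thm (b3 b a)) x)

    ∣-¬ : Γ ⊢ ((¬' a) ∣ b) ⇔ (¬' (a ∣ b))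
    ∣-¬ {a = a} {b} = ⇔-trans ¬¬-⇔ (¬-cong (thm (b4 b a)))

    □-independent : Γ ⊢ □ b → Γ ⊢ a ⊗ b
    □-independent = □-map (⇔-intro (∣-elim var₀ var₁)
                                   (by-contradiction var₁ (∣-elim (⇔-from ∣-¬ var₀) var₂)))

    □-∣⇒⊗ : Γ ⊢ □ a → Γ ⊢ □ (a ∣ b) → Γ ⊢ a ⊗ b
    □-∣⇒⊗ = □-map₂ (⇔-of-derivables var₀ var₁)

    ⊗⇒□-∣ : Γ ⊢ □ a → Γ ⊢ a ⊗ b → Γ ⊢ □ (a ∣ b)
    ⊗⇒□-∣ = □-map₂ (⇔-from var₀ var₁)

    ◇⇒□-∣ : Γ ⊢ ◇ b → Γ ⊢ □ a → Γ ⊢ □ (a ∣ b)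
    ◇⇒□-∣ {b = b} {a = a} ◇x □y = ⇒-elim (⇒-elim (thm (b1 b a)) (□-map (⇒-intro var₁) □y)) ◇x

  □-∣ : ∀ L φ ψ → ⊢[ L ] ((□ ψ) ⇒ (□ (ψ ∣ φ)))
  □-∣ DmBL φ ψ = closed (⇒-intro (⊗⇒□-∣ var₀ (⇔-from (thm (b5 φ ψ)) (□-independent var₀))))
    where open Derivations DmBL
  □-∣ DmBL∗ φ ψ = closed (⇒-intro (cases {a = □ (¬' φ)} impossible possible))
    where
    open Derivations DmBL∗
    possible : ((◇ φ) ∷ (□ ψ) ∷ []) ⊢ □ (ψ ∣ φ)
    possible = ◇⇒□-∣ var₀ var₁
    impossible : ((□ (¬' φ)) ∷ (□ ψ) ∷ []) ⊢ □ (ψ ∣ φ)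
    impossible = ⊗⇒□-∣ var₁ (⇔-to (thm (b5-weak-A φ ψ)) (□-∣⇒⊗ var₁ (◇⇒□-∣ (□⇒◇ var₀) var₁)))

  module Conditional (L : Logic) (φ : Form Θ) where
    open Derivations L

    private
      variable
        Γ : List (Form Θ)
        a b A B : Form Θ

    ∣-necessitation : ⊢[ L ] a → Γ ⊢ a ∣ φ
    ∣-necessitation {a} t = □-elim (⇒-elim (thm (□-∣ L φ a)) (thm (m1 t)))

    ∣-map : (a ∷ []) ⊢ b → Γ ⊢ a ∣ φ → Γ ⊢ b ∣ φ
    ∣-map {a} {b} x = ⇒-elim (⇒-elim (thm (b2 φ a b)) (∣-necessitation (closed (⇒-intro x))))

    ∣-⇒ : Γ ⊢ ((a ⇒ b) ∣ φ) ⇔ ((a ∣ φ) ⇒ (b ∣ φ))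
    ∣-⇒ {a = a} {b} = ⇔-intro (⇒-elim (thm (b2 φ a b)) var₀) (cases {a = a ∣ φ}
      (∣-map (⇒-intro var₁) (⇒-elim var₁ var₀))
      (∣-map (⇒-intro (¬-elim var₁ var₀)) (⇔-from ∣-¬ var₀)))

    ∣-¬-cong : Γ ⊢ (a ∣ φ) ⇔ A → Γ ⊢ ((¬' a) ∣ φ) ⇔ (¬' A)
    ∣-¬-cong e = ⇔-trans ∣-¬ (¬-cong e)

    ∣-⇒-cong : Γ ⊢ (a ∣ φ) ⇔ A → Γ ⊢ (b ∣ φ) ⇔ B → Γ ⊢ ((a ⇒ b) ∣ φ) ⇔ (A ⇒ B)
    ∣-⇒-cong e f = ⇔-trans ∣-⇒ (⇒-cong e f)

    ∣-∨ : Γ ⊢ ((a ∨' b) ∣ φ) ⇔ ((a ∣ φ) ∨' (b ∣ φ))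
    ∣-∨ = ∣-⇒-cong (∣-¬-cong ⇔-refl) ⇔-refl

    ∣-∧ : Γ ⊢ ((a ∧' b) ∣ φ) ⇔ ((a ∣ φ) ∧' (b ∣ φ))
    ∣-∧ = ∣-¬-cong (∣-⇒-cong (∣-¬-cong (∣-¬-cong ⇔-refl)) (∣-¬-cong ⇔-refl))

    ∣-⊤ : Γ ⊢ (⊤' ∣ φ) ⇔ ⊤'
    ∣-⊤ = ⇔-of-derivables (∣-necessitation ⇒-refl) (thm ⇒-refl)

    ∣-⊥ : Γ ⊢ (⊥' ∣ φ) ⇔ ⊥'
    ∣-⊥ = ∣-¬-cong ∣-⊤

mainTheorem4 : {Θ : Set} (θ₀ : Θ) → let open Abbrev θ₀ in
    (L : Logic) → (φ ψ η : Form Θ) →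
      ((((¬' ψ) ∣ φ) ≡[ L ] (¬' (ψ ∣ φ)))
      × (((ψ ∧' η) ∣ φ) ≡[ L ] ((ψ ∣ φ) ∧' (η ∣ φ)))
      × (((ψ ∨' η) ∣ φ) ≡[ L ] ((ψ ∣ φ) ∨' (η ∣ φ)))
      × (((ψ ⇒ η) ∣ φ) ≡[ L ] ((ψ ∣ φ) ⇒ (η ∣ φ))))
      × (⊢[ L ] ((□ ψ) ⇒ (□ (ψ ∣ φ))))
      × ((⊤' ∣ φ) ≡[ L ] ⊤')
      × ((⊥' ∣ φ) ≡[ L ] ⊥')
mainTheorem4 θ₀ L φ ψ η =
  (closed ∣-¬ , closed ∣-∧ , closed ∣-∨ , closed ∣-⇒) , □-∣ L φ ψ , closed ∣-⊤ , closed ∣-⊥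
  where
  open Calculus θ₀
  open Derivations L
  open Conditional L φ
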